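{- Let $G=(I\uplus S\uplus O,E)$ be a splitter network with capacities $c:I\uplus O\to[0,1]$, and $(t,F)$ a steady-state for $(G,c)$. Let $\overleftarrow{G}$ be the reverse splitter network, with vertex set $O\uplus S\uplus I$ (inputs $O$, outputs $I$) and arc set $\overleftarrow{E}=\{vu: uv\in E\}$. Define $\overleftarrow{t}(vu)=t(uv)$ for every $uv\in E$, and $\overleftarrow{F}=\{vu : uv\in E\setminus F\}$. Then $(\overleftarrow{t},\overleftarrow{F})$ is a steady-state for $(\overleftarrow{G},c)$.
   Context: A splitter network is a finite directed graph $G$ (loops and parallel arcs allowed) with arc set $E$ whose vertex set is partitioned as $I\uplus S\uplus O$, where each input $i\in I$ has out-degree $1$ and in-degree $0$, each output $o\in O$ has in-degree $1$ and out-degree $0$, and each splitter $s\in S$ has in-degree $2$ and out-degree $2$. $\delta^+(v),\delta^-(v)$ denote outgoing/incoming arcs of $v$. A capacity function is a map $c:I\cup O\to[0,1]$. A steady-state for $(G,c)$ is a pair $(t,F)$ with $t:E\to[0,1]$ and $F\subseteq E$ (fluid arcs; arcs of $E\setminus F$ are saturated) such that: (R3) for each input $i$ with $\delta^+(i)=\{e\}$, $t(e)\le c(i)$, and if $e\in F$ then $t(e)=c(i)$; (R4) for each output $o$ with $\delta^-(o)=\{e\}$, $t(e)\le c(o)$, and if $e\notin F$ then $t(e)=c(o)$; (R5) for each splitter $s$, $t(\delta^-(s))=t(\delta^+(s))$; (R6) for each splitter $s$ with $\delta^-(s)=\{e_1,e_2\}$ and $e_1\notin F$, $t(e_1)\ge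 t(e_2)$; (R7) for each splitter $s$ with $\delta^+(s)=\{e_1,e_2\}$ and $e_1\in F$, $t(e_1)\ge t(e_2)$; (R8) for any arcs $uv\in E\setminus F$ and $vw\in F$, $t(uv)=1$ or $t(vw)=1$. -}

module Defs where

open import Data.Nat using (ℕ)
open import Data.Fin using (Fin)
open import Data.Bool using (Bool; true; false; not)
open import Data.Product using (_×_; Σ; ∃; ∃-syntax)
open import Data.Sum using (_⊎_)
open import Relation.Binary.PropositionalEquality using (_≡_; _≢_)
open import Function.Bundles using (_⇔_)

-- The paper uses the real interval [0,1]; the stdlib has
-- no reals, so we quantify over an arbitrary carrier with the operations
-- the definitions mention.  ℝ with its usual
-- +, ≤, 0, 1 is an instance.
record Scalars : Set₁ where
  field
    Carrier : Set
    _+_     : Carrier → Carrier → Carrier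
    _≤_     : Carrier → Carrier → Set
    0#      : Carrier
    1#      : Carrier

data Vtx (nI nS nO : ℕ) : Set where
  inp : Fin nI → Vtx nI nS nO
  spl : Fin nS → Vtx nI nS nO
  out : Fin nO → Vtx nI nS nO

-- A finite directed multigraph (loops and parallel arcs allowed):
-- arcs are Fin m, each with a tail and a head.
record Graph : Set where
  field
    nI nS nO m : ℕ
    tail head  : Fin m → Vtx nI nS nO

module _ (G : Graph) where
  open Graph G

  OutIs₁ : Vtx nI nS nO → Fin m → Set
  OutIs₁ v e = ∀ e′ → (tail e′ ≡ v) ⇔ (e′ ≡ e)

  InIs₁ : Vtx nI nS nO → Fin m → Set
  InIs₁ v e = ∀ e′ → (head e′ ≡ v) ⇔ (e′ ≡ e)

  OutIs₂ : Vtx nI nS nO → Fin m → Fin m → Set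
  OutIs₂ v e₁ e₂ = e₁ ≢ e₂ × (∀ e′ → (tail e′ ≡ v) ⇔ (e′ ≡ e₁ ⊎ e′ ≡ e₂))

  InIs₂ : Vtx nI nS nO → Fin m → Fin m → Set
  InIs₂ v e₁ e₂ = e₁ ≢ e₂ × (∀ e′ → (head e′ ≡ v) ⇔ (e′ ≡ e₁ ⊎ e′ ≡ e₂))

  record IsSplitterNetwork : Set where
    field
      input-out  : ∀ i → ∃[ e ] OutIs₁ (inp i) e
      input-in   : ∀ i e → head e ≢ inp i
      output-in  : ∀ o → ∃[ e ] InIs₁ (out o) e
      output-out : ∀ o e → tail e ≢ out o
      split-in   : ∀ s → ∃[ e₁ ] ∃[ e₂ ] InIs₂ (spl s) e₁ e₂
      split-out  : ∀ s → ∃[ e₁ ] ∃[ e₂ ] OutIs₂ (spl s) e₁ e₂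

  -- Steady state (t, F) for (G, c), with c given on I by cI and on O by cO.
  -- F is a subset of the arcs given by its characteristic function
  -- (e ∈ F  iff  F e ≡ true).
  record IsSteadyState (K : Scalars)
           (cI : Fin nI → Scalars.Carrier K) (cO : Fin nO → Scalars.Carrier K)
           (t : Fin m → Scalars.Carrier K) (F : Fin m → Bool) : Set where
    open Scalars K
    field
      t-range : ∀ e → 0# ≤ t e × t e ≤ 1#
      R3 : ∀ i e → OutIs₁ (inp i) e →
             t e ≤ cI i × (F e ≡ true → t e ≡ cI i)
      R4 : ∀ o e → InIs₁ (out o) e →
             t e ≤ cO o × (F e ≡ false → t e ≡ cO o)
      R5 : ∀ s e₁ e₂ e₃ e₄ → InIs₂ (spl s) e₁ e₂ → OutIs₂ (spl s) e₃ e₄ →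
             (t e₁ + t e₂) ≡ (t e₃ + t e₄)
      R6 : ∀ s e₁ e₂ → InIs₂ (spl s) e₁ e₂ → F e₁ ≡ false → t e₂ ≤ t e₁
      R7 : ∀ s e₁ e₂ → OutIs₂ (spl s) e₁ e₂ → F e₁ ≡ true → t e₂ ≤ t e₁
      R8 : ∀ e₁ e₂ → head e₁ ≡ tail e₂ → F e₁ ≡ false → F e₂ ≡ true →
             t e₁ ≡ 1# ⊎ t e₂ ≡ 1#

flipVtx : ∀ {nI nS nO} → Vtx nI nS nO → Vtx nO nS nI
flipVtx (inp i) = out i
flipVtx (spl s) = spl s
flipVtx (out o) = inp o

reverse : Graph → Graph
reverse G = record
  { nI = nO ; nS = nS ; nO = nI ; m = m
  ; tail = λ e → flipVtx (head e)
  ; head = λ e → flipVtx (tail e) }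
  where open Graph G

reverseF : ∀ {m} → (Fin m → Bool) → (Fin m → Bool)
reverseF F e = not (F e)

-- Reversing every arc swaps δ⁺ and δ⁻ and complementing F swaps fluid and
-- saturated arcs, so each steady-state rule of G becomes its mirror rule in
-- the reverse network: R3 ↔ R4, R6 ↔ R7, R5 read backwards, and R8 for the
-- reversed pair of consecutive arcs.
module Submission where

open import Defs
open import Data.Fin using (Fin)
open import Data.Bool using (Bool)
open import Data.Bool.Properties using (not-injective)
open import Data.Product using (_×_; _,_; map₂)
open import Data.Product.Function.NonDependent.Propositional using (_×-⇔_)
open import Data.Sum using (swap)
open import Relation.Binary.PropositionalEquality using (_≡_; refl; sym; cong)
open import Function using (_∘′_)
open import Function.Bundles using (_⇔_; mk⇔; Equivalence)
import Function.Properties.Equivalence as ⇔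
open Scalars using (Carrier)
open Graph using (nI; nO; m)

flipVtx-injective : ∀ {nI nS nO} {x y : Vtx nI nS nO} → flipVtx x ≡ flipVtx y → x ≡ y
flipVtx-injective {x = inp i} {inp .i} refl = refl
flipVtx-injective {x = spl s} {spl .s} refl = refl
flipVtx-injective {x = out o} {out .o} refl = refl

flipVtx-≡⇔≡ : ∀ {nI nS nO} {x y : Vtx nI nS nO} → (flipVtx x ≡ flipVtx y) ⇔ (x ≡ y)
flipVtx-≡⇔≡ = mk⇔ flipVtx-injective (cong flipVtx)

∀-⇔-congˡ : ∀ {A : Set} {X Y P : A → Set} →
  (∀ a → X a ⇔ Y a) → (∀ a → X a ⇔ P a) ⇔ (∀ a → Y a ⇔ P a)
∀-⇔-congˡ X⇔Y = mk⇔ (λ h a → ⇔.trans (⇔.sym (X⇔Y a)) (h a))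
                     (λ h a → ⇔.trans (X⇔Y a) (h a))

module _ (G : Graph) where
  reverse-OutIs₁ : ∀ v e → OutIs₁ (reverse G) (flipVtx v) e ⇔ InIs₁ G v e
  reverse-OutIs₁ v e = ∀-⇔-congˡ (λ _ → flipVtx-≡⇔≡)

  reverse-InIs₁ : ∀ v e → InIs₁ (reverse G) (flipVtx v) e ⇔ OutIs₁ G v e
  reverse-InIs₁ v e = ∀-⇔-congˡ (λ _ → flipVtx-≡⇔≡)

  reverse-OutIs₂ : ∀ v e₁ e₂ → OutIs₂ (reverse G) (flipVtx v) e₁ e₂ ⇔ InIs₂ G v e₁ e₂
  reverse-OutIs₂ v e₁ e₂ = ⇔.refl ×-⇔ ∀-⇔-congˡ (λ _ → flipVtx-≡⇔≡)

  reverse-InIs₂ : ∀ v e₁ e₂ → InIs₂ (reverse G) (flipVtx v) e₁ e₂ ⇔ OutIs₂ G v e₁ e₂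
  reverse-InIs₂ v e₁ e₂ = ⇔.refl ×-⇔ ∀-⇔-congˡ (λ _ → flipVtx-≡⇔≡)

  reverse-isSplitterNetwork : IsSplitterNetwork G → IsSplitterNetwork (reverse G)
  reverse-isSplitterNetwork sn = record
    { input-out  = λ o → map₂ (Equivalence.from (reverse-OutIs₁ (out o) _)) (output-in o)
    ; input-in   = λ o e p → output-out o e (flipVtx-injective p)
    ; output-in  = λ i → map₂ (Equivalence.from (reverse-InIs₁ (inp i) _)) (input-out i)
    ; output-out = λ i e p → input-in i e (flipVtx-injective p)
    ; split-in   = λ s → map₂ (map₂ (Equivalence.from (reverse-InIs₂ (spl s) _ _))) (split-out s)
    ; split-out  = λ s → map₂ (map₂ (Equivalence.from (reverse-OutIs₂ (spl s) _ _))) (split-in s)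
    }
    where open IsSplitterNetwork sn

  -- Since true = not false definitionally, not-injective turns
  -- reverseF F e ≡ true into F e ≡ false (and dually).
  reverse-isSteadyState : ∀ {K : Scalars} {cI cO t F} →
    IsSteadyState G K cI cO t F → IsSteadyState (reverse G) K cO cI t (reverseF F)
  reverse-isSteadyState ss = record
    { t-range = t-range
    ; R3 = λ o e h → map₂ (λ fluid → fluid ∘′ not-injective)
                          (R4 o e (Equivalence.to (reverse-OutIs₁ (out o) e) h))
    ; R4 = λ i e h → map₂ (λ fluid → fluid ∘′ not-injective)
                          (R3 i e (Equivalence.to (reverse-InIs₁ (inp i) e) h))
    ; R5 = λ s e₁ e₂ e₃ e₄ hᵢ hₒ →
             sym (R5 s e₃ e₄ e₁ e₂ (Equivalence.to (reverse-OutIs₂ (spl s) e₃ e₄) hₒ)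
                                   (Equivalence.to (reverse-InIs₂ (spl s) e₁ e₂) hᵢ))
    ; R6 = λ s e₁ e₂ h q → R7 s e₁ e₂ (Equivalence.to (reverse-InIs₂ (spl s) e₁ e₂) h) (not-injective q)
    ; R7 = λ s e₁ e₂ h q → R6 s e₁ e₂ (Equivalence.to (reverse-OutIs₂ (spl s) e₁ e₂) h) (not-injective q)
    ; R8 = λ e₁ e₂ p q r → swap (R8 e₂ e₁ (sym (flipVtx-injective p)) (not-injective r) (not-injective q))
    }
    where open IsSteadyState ss

lemma11 : (K : Scalars) (G : Graph) → IsSplitterNetwork G →
    (cI : Fin (nI G) → Carrier K) (cO : Fin (nO G) → Carrier K) →
    (∀ i → Scalars._≤_ K (Scalars.0# K) (cI i) × Scalars._≤_ K (cI i) (Scalars.1# K)) →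
    (∀ o → Scalars._≤_ K (Scalars.0# K) (cO o) × Scalars._≤_ K (cO o) (Scalars.1# K)) →
    (t : Fin (m G) → Carrier K) (F : Fin (m G) → Bool) →
    IsSteadyState G K cI cO t F →
    IsSplitterNetwork (reverse G) × IsSteadyState (reverse G) K cO cI t (reverseF F)
lemma11 K G sn cI cO _ _ t F ss = reverse-isSplitterNetwork G sn , reverse-isSteadyState G ss
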